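{- For every integer $k\ge 0$, $v_{1+3k}\equiv v_{2+3k}\equiv \frac{1}{k+1}\binom{2k}{k}\pmod 3$, and for every integer $k\ge 1$, $v_{3k}\equiv 0\pmod 3$.
   Context: For an integer $n\ge 1$ let $v_n=\Big[(1-x)\prod_{j=0}^{2n-3}(2n-3-j+jx)\Big]_{x^{n-1}}$, where $[f(x)]_{x^m}$ denotes the coefficient of $x^m$ in $f$ (an empty product equals $1$, so $v_1=1$). The paper also sets $v_0=-1$. -}

module Defs where

open import Data.Nat as ℕ using (ℕ; zero; suc; _∸_)
open import Data.Nat.Combinatorics using (_C_)
open import Data.Nat.DivMod using (_/_)
open import Data.Integer as ℤ using (ℤ; +_; -[1+_])
open import Data.List using (List; []; _∷_; upTo; foldr; map)

-- Polynomials over ℤ as coefficient lists (constant term first).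
Poly : Set
Poly = List ℤ

_⊕_ : Poly → Poly → Poly
[] ⊕ q = q
(a ∷ p) ⊕ [] = a ∷ p
(a ∷ p) ⊕ (b ∷ q) = (a ℤ.+ b) ∷ (p ⊕ q)

scale : ℤ → Poly → Poly
scale c = map (c ℤ.*_)

_⊗_ : Poly → Poly → Poly
[] ⊗ q = []
(a ∷ p) ⊗ q = scale a q ⊕ (ℤ.+ 0 ∷ (p ⊗ q))

coeff : Poly → ℕ → ℤ
coeff [] m = ℤ.+ 0
coeff (a ∷ p) zero = a
coeff (a ∷ p) (suc m) = coeff p m

lin : ℤ → ℤ → Poly
lin a b = a ∷ b ∷ []

-- ∏_{j=0}^{m-1} ((m-1-j) + j x); with m = 2n-2 this is ∏_{j=0}^{2n-3} (2n-3-j + j x)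
prodPoly : ℕ → Poly
prodPoly m = foldr (λ j acc → lin (+ (m ∸ 1 ∸ j)) (+ j) ⊗ acc) (ℤ.+ 1 ∷ []) (upTo m)

-- v_n = [ (1-x) ∏_{j=0}^{2n-3} (2n-3-j+jx) ]_{x^{n-1}} for n ≥ 1, and v_0 = -1
v : ℕ → ℤ
v zero = -[1+ 0 ]
v (suc k) = coeff (lin (+ 1) (-[1+ 0 ]) ⊗ prodPoly (2 ℕ.* k)) k

-- Catalan number (1/(k+1)) binom(2k,k)  (the division is exact)
catalan : ℕ → ℕ
catalan k = ((2 ℕ.* k) C k) / suc k

_≡_[mod_] : ℤ → ℤ → ℕ → Set
a ≡ b [mod m ] = (+ m) Data.Integer.Divisibility.∣ (a ℤ.- b)
  where import Data.Integer.Divisibility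

{-# OPTIONS --safe #-}
-- Write linProd a s for ∏_{i<a} ((a-1-i) + (s+i) x), so that v (n+1) is the coefficient of x^n
-- in (1 - x) · linProd (2n) 0. Modulo 3 a factor only depends on a-1-i and s+i modulo 3, so
-- three consecutive factors collapse: for a ≡ s ≡ 0 they give 2 · (1+x) · 2x ≡ x(1+x), and for
-- a ≡ 0, s ≡ 2 they give (2+2x) · 1 · x = 2x(1+x). Hence linProd (6k) 0 ≡ (x+x²)^{2k} and
-- linProd (6k+2) 0 ≡ x · 4^k (x+x²)^{2k}; in both cases the coefficient needed is the one of
-- x^k in (1 - x)(1 + x)^{2k}, namely C(2k,k) - C(2k,k-1), the k-th Catalan number. For n = 3k+2
-- the first factor of linProd (6k+4) 0 is (6k+3) + 0 x ≡ 0.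
module Submission where

open import Defs
open import Data.Nat using (ℕ; zero; suc; _≤_; _<_; z≤n; _!)
import Data.Nat as ℕ
import Data.Nat.Properties as ℕₚ
open import Data.Integer as ℤ using (ℤ; +_; 0ℤ; 1ℤ; -1ℤ)
open import Data.Product using (_×_; _,_)
open import Data.List using ([]; _∷_; foldr; applyUpTo)
open import Data.Nat.Combinatorics
  using (_C_; nCk≡nC[n∸k]; nCn≡1; nCk+nC[k+1]≡[n+1]C[k+1]; nCk≡n!/k![n-k]!; k![n∸k]!∣n!;
         [n-k]*d[k+1]≡[k+1]*d[k])
open import Level using (0ℓ)
open import Relation.Binary.Bundles using (Setoid)
open import Relation.Binary.PropositionalEquality
import Relation.Binary.Reasoning.Setoid as SetoidReasoning

nC0≡1 : ∀ n → n C 0 ≡ 1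
nC0≡1 n = trans (nCk≡nC[n∸k] {n = n} z≤n) (nCn≡1 n)

-- The integer operators are opened only inside this module: outside it, _+_ and _*_ are those
-- of ℕ, as in the statement.
module _ where
  open import Data.Integer.Base using (_+_; _*_; _-_; -_)
  open import Data.Integer.Properties
    using (+-inverseʳ; +-minus-telescope; pos-+; pos-*; *-zeroʳ; *-identityˡ; +-identityˡ; +-identityʳ)
  open import Data.Integer.Divisibility.Signed
    using (_∣_; divides; ∣⇒∣ᵤ; ∣m∣n⇒∣m+n; ∣m⇒∣-m; ∣n⇒∣m*n; ∣m⇒∣m*n)
  open import Data.Integer.Tactic.RingSolver using (solve-∀)

  -- _≡_[mod_] unfolds to divisibility of ∣ a - b ∣, from which Agda cannot infer a and b;
  -- this record version keeps them visible.
  infix 4 _≈_[mod_]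
  record _≈_[mod_] (a b : ℤ) (n : ℕ) : Set where
    constructor mod-by
    field
      divides-difference : + n ∣ a - b

  module _ {n : ℕ} where

    ≈⇒≡mod : ∀ {a b} → a ≈ b [mod n ] → a ≡ b [mod n ]
    ≈⇒≡mod (mod-by n∣a-b) = ∣⇒∣ᵤ n∣a-b

    mod-via : ∀ {a b} c → a - b ≡ c → + n ∣ c → a ≈ b [mod n ]
    mod-via c a-b≡c n∣c = mod-by (subst (+ n ∣_) (sym a-b≡c) n∣c)

    mod-refl : ∀ {a} → a ≈ a [mod n ]
    mod-refl {a} = mod-via 0ℤ (+-inverseʳ a) (divides 0ℤ refl)

    mod-reflexive : ∀ {a b} → a ≡ b → a ≈ b [mod n ]
    mod-reflexive refl = mod-refl

    mod-sym : ∀ {a b} → a ≈ b [mod n ] → b ≈ a [mod n ]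
    mod-sym {a} {b} (mod-by n∣a-b) = mod-via _ (negate b a) (∣m⇒∣-m n∣a-b)
      where
      negate : ∀ b a → b - a ≡ - (a - b)
      negate = solve-∀

    mod-trans : ∀ {a b c} → a ≈ b [mod n ] → b ≈ c [mod n ] → a ≈ c [mod n ]
    mod-trans {a} {b} {c} (mod-by n∣a-b) (mod-by n∣b-c) =
      mod-via _ (sym (+-minus-telescope a b c)) (∣m∣n⇒∣m+n n∣a-b n∣b-c)

    +-cong-mod : ∀ {a b c d} → a ≈ b [mod n ] → c ≈ d [mod n ] → (a + c) ≈ b + d [mod n ]
    +-cong-mod {a} {b} {c} {d} (mod-by n∣a-b) (mod-by n∣c-d) =
      mod-via _ (regroup a b c d) (∣m∣n⇒∣m+n n∣a-b n∣c-d)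
      where
      regroup : ∀ a b c d → (a + c) - (b + d) ≡ (a - b) + (c - d)
      regroup = solve-∀

    *-cong-mod : ∀ {a b c d} → a ≈ b [mod n ] → c ≈ d [mod n ] → (a * c) ≈ b * d [mod n ]
    *-cong-mod {a} {b} {c} {d} (mod-by n∣a-b) (mod-by n∣c-d) =
      mod-via _ (regroup a b c d) (∣m∣n⇒∣m+n (∣n⇒∣m*n a n∣c-d) (∣m⇒∣m*n d n∣a-b))
      where
      regroup : ∀ a b c d → a * c - b * d ≡ a * (c - d) + (a - b) * d
      regroup = solve-∀

    +[r+q*n]≈+r : ∀ r q → (+ (r ℕ.+ q ℕ.* n)) ≈ + r [mod n ]
    +[r+q*n]≈+r r q = mod-via (+ q * + n) difference (divides (+ q) refl)
      where
      cancel : ∀ x y → (x + y) - x ≡ y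
      cancel = solve-∀
      difference : + (r ℕ.+ q ℕ.* n) - + r ≡ + q * + n
      difference = begin
        + (r ℕ.+ q ℕ.* n) - + r  ≡⟨ cong (_- + r) (trans (pos-+ r (q ℕ.* n)) (cong (_+_ (+ r)) (pos-* q n))) ⟩
        (+ r + + q * + n) - + r  ≡⟨ cancel (+ r) (+ q * + n) ⟩
        + q * + n                ∎
        where open ≡-Reasoning

  mod-setoid : ℕ → Setoid 0ℓ 0ℓ
  mod-setoid n = record
    { Carrier       = ℤ
    ; _≈_           = _≈_[mod n ]
    ; isEquivalence = record { refl = mod-refl ; sym = mod-sym ; trans = mod-trans }
    }

  Seq : Set
  Seq = ℕ → ℤ

  shift : Seq → Seq
  shift f zero    = 0ℤ
  shift f (suc m) = f m

  shiftBy : ℕ → Seq → Seq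
  shiftBy zero    f = f
  shiftBy (suc t) f = shift (shiftBy t f)

  mulLin : ℤ → ℤ → Seq → Seq
  mulLin a b f m = a * f m + b * shift f m

  infixr 6 _·_
  _·_ : ℤ → Seq → Seq
  (c · f) m = c * f m

  [1+x]^ : ℕ → Seq
  [1+x]^ t m = + (t C m)

  [x+x²]^ : ℕ → Seq
  [x+x²]^ t = shiftBy t ([1+x]^ t)

  infix 4 _≋_[mod_]
  _≋_[mod_] : Seq → Seq → ℕ → Set
  f ≋ g [mod n ] = ∀ m → f m ≈ g m [mod n ]

  module _ {n : ℕ} where

    ≋-reflexive : ∀ {f g} → f ≗ g → f ≋ g [mod n ]
    ≋-reflexive f≗g m = mod-reflexive (f≗g m)

    ≋-trans : ∀ {f g h} → f ≋ g [mod n ] → g ≋ h [mod n ] → f ≋ h [mod n ]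
    ≋-trans f≋g g≋h m = mod-trans (f≋g m) (g≋h m)

    shift-cong : ∀ {f g} → f ≋ g [mod n ] → shift f ≋ shift g [mod n ]
    shift-cong f≋g zero    = mod-refl
    shift-cong f≋g (suc m) = f≋g m

    mulLin-cong : ∀ {a a′ b b′ f g} → a ≈ a′ [mod n ] → b ≈ b′ [mod n ] → f ≋ g [mod n ] →
                  mulLin a b f ≋ mulLin a′ b′ g [mod n ]
    mulLin-cong a≈a′ b≈b′ f≋g m =
      +-cong-mod (*-cong-mod a≈a′ (f≋g m)) (*-cong-mod b≈b′ (shift-cong f≋g m))

    ·-cong : ∀ {c c′ f g} → c ≈ c′ [mod n ] → f ≋ g [mod n ] → c · f ≋ c′ · g [mod n ]
    ·-cong c≈c′ f≋g m = *-cong-mod c≈c′ (f≋g m)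

    c≈1⇒c·f≋f : ∀ {c f} → c ≈ 1ℤ [mod n ] → c · f ≋ f [mod n ]
    c≈1⇒c·f≋f {f = f} c≈1 m = mod-trans (*-cong-mod c≈1 mod-refl) (mod-reflexive (*-identityˡ (f m)))

  ≋-setoid : ℕ → Setoid 0ℓ 0ℓ
  ≋-setoid n = record
    { Carrier       = Seq
    ; _≈_           = _≋_[mod n ]
    ; isEquivalence = record
      { refl  = λ m → mod-refl
      ; sym   = λ f≋g m → mod-sym (f≋g m)
      ; trans = ≋-trans
      }
    }

  coeff-⊕ : ∀ p q m → coeff (p ⊕ q) m ≡ coeff p m + coeff q m
  coeff-⊕ []      q       m       = sym (+-identityˡ _)
  coeff-⊕ (a ∷ p) []      m       = sym (+-identityʳ _)
  coeff-⊕ (a ∷ p) (b ∷ q) zero    = refl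
  coeff-⊕ (a ∷ p) (b ∷ q) (suc m) = coeff-⊕ p q m

  coeff-scale : ∀ c q m → coeff (scale c q) m ≡ c * coeff q m
  coeff-scale c []      m       = sym (*-zeroʳ c)
  coeff-scale c (a ∷ q) zero    = refl
  coeff-scale c (a ∷ q) (suc m) = coeff-scale c q m

  coeff-[0] : ∀ m → coeff (0ℤ ∷ []) m ≡ 0ℤ
  coeff-[0] zero    = refl
  coeff-[0] (suc m) = refl

  coeff-[c]⊗ : ∀ c q m → coeff ((c ∷ []) ⊗ q) m ≡ c * coeff q m
  coeff-[c]⊗ c q m = begin
    coeff (scale c q ⊕ (0ℤ ∷ [])) m          ≡⟨ coeff-⊕ (scale c q) _ m ⟩
    coeff (scale c q) m + coeff (0ℤ ∷ []) m  ≡⟨ cong₂ _+_ (coeff-scale c q m) (coeff-[0] m) ⟩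
    c * coeff q m + 0ℤ                       ≡⟨ +-identityʳ _ ⟩
    c * coeff q m                            ∎
    where open ≡-Reasoning

  coeff-lin-⊗ : ∀ a b q → coeff (lin a b ⊗ q) ≗ mulLin a b (coeff q)
  coeff-lin-⊗ a b q zero    =
    trans (coeff-⊕ (scale a q) _ 0) (cong₂ _+_ (coeff-scale a q 0) (sym (*-zeroʳ b)))
  coeff-lin-⊗ a b q (suc m) =
    trans (coeff-⊕ (scale a q) _ (suc m)) (cong₂ _+_ (coeff-scale a q (suc m)) (coeff-[c]⊗ b q m))

  mulLin-zero : ∀ a b → mulLin a b (λ _ → 0ℤ) ≗ λ _ → 0ℤ
  mulLin-zero a b zero    = cong₂ _+_ (*-zeroʳ a) (*-zeroʳ b)
  mulLin-zero a b (suc m) = cong₂ _+_ (*-zeroʳ a) (*-zeroʳ b)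

  shiftBy-+ : ∀ t f i → shiftBy t f (t ℕ.+ i) ≡ f i
  shiftBy-+ zero    f i = refl
  shiftBy-+ (suc t) f i = shiftBy-+ t f i

  shiftBy-cong : ∀ t {f g} → f ≗ g → shiftBy t f ≗ shiftBy t g
  shiftBy-cong zero    f≗g m       = f≗g m
  shiftBy-cong (suc t) f≗g zero    = refl
  shiftBy-cong (suc t) f≗g (suc m) = shiftBy-cong t f≗g m

  shiftBy-mulLin : ∀ t a b f → mulLin a b (shiftBy t f) ≗ shiftBy t (mulLin a b f)
  shiftBy-mulLin zero    a b f m       = refl
  shiftBy-mulLin (suc t) a b f zero    = mulLin-zero a b 0
  shiftBy-mulLin (suc t) a b f (suc m) = shiftBy-mulLin t a b f m

  mulLin-shiftBy-+ : ∀ s a b f i → mulLin a b (shiftBy s f) (s ℕ.+ i) ≡ mulLin a b f i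
  mulLin-shiftBy-+ s a b f i = trans (shiftBy-mulLin s a b f (s ℕ.+ i)) (shiftBy-+ s (mulLin a b f) i)

  mulLin-1-[-1]-suc : ∀ f m {c} → f (suc m) ≡ c + f m → mulLin 1ℤ -1ℤ f (suc m) ≡ c
  mulLin-1-[-1]-suc f m {c} eq = trans (cong (λ z → 1ℤ * z + -1ℤ * f m) eq) (cancel c (f m))
    where
    cancel : ∀ x y → 1ℤ * (x + y) + -1ℤ * y ≡ x
    cancel = solve-∀

  [1+x]^-suc : ∀ t → mulLin 1ℤ 1ℤ ([1+x]^ t) ≗ [1+x]^ (suc t)
  [1+x]^-suc t zero    = begin
    1ℤ * + (t C 0) + 1ℤ * 0ℤ  ≡⟨ trans (+-identityʳ _) (*-identityˡ _) ⟩
    + (t C 0)                 ≡⟨ cong +_ (trans (nC0≡1 t) (sym (nC0≡1 (suc t)))) ⟩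
    + (suc t C 0)             ∎
    where open ≡-Reasoning
  [1+x]^-suc t (suc m) = begin
    1ℤ * + (t C suc m) + 1ℤ * + (t C m)  ≡⟨ cong₂ _+_ (*-identityˡ (+ (t C suc m))) (*-identityˡ (+ (t C m))) ⟩
    + (t C suc m) + + (t C m)            ≡⟨ pos-+ (t C suc m) (t C m) ⟨
    + (t C suc m ℕ.+ t C m)              ≡⟨ cong +_ (trans (ℕₚ.+-comm (t C suc m) (t C m))
                                                               (nCk+nC[k+1]≡[n+1]C[k+1] t m)) ⟩
    + (suc t C suc m)                    ∎
    where open ≡-Reasoning

  [x+x²]^-suc : ∀ t → shift (mulLin 1ℤ 1ℤ ([x+x²]^ t)) ≗ [x+x²]^ (suc t)
  [x+x²]^-suc t zero    = refl
  [x+x²]^-suc t (suc m) = trans (shiftBy-mulLin t 1ℤ 1ℤ ([1+x]^ t) m) (shiftBy-cong t ([1+x]^-suc t) m)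

  mulLin-[2][1+x][2x] : ∀ f →
    mulLin (+ 2) 0ℤ (mulLin 1ℤ 1ℤ (mulLin 0ℤ (+ 2) f)) ≗ (+ 4) · shift (mulLin 1ℤ 1ℤ f)
  mulLin-[2][1+x][2x] f zero    = refl
  mulLin-[2][1+x][2x] f (suc m) = expand (f (suc m)) (f m) (shift f m)
    where
    expand : ∀ w x y →
      + 2 * (1ℤ * (0ℤ * w + + 2 * x) + 1ℤ * (0ℤ * x + + 2 * y)) + 0ℤ ≡ + 4 * (1ℤ * x + 1ℤ * y)
    expand = solve-∀

  mulLin-[2+2x][1][x] : ∀ c f →
    mulLin (+ 2) (+ 2) (mulLin 1ℤ 0ℤ (mulLin 0ℤ 1ℤ (c · f))) ≗ (+ 2 * c) · shift (mulLin 1ℤ 1ℤ f)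
  mulLin-[2+2x][1][x] c f zero          = sym (*-zeroʳ (+ 2 * c))
  mulLin-[2+2x][1][x] c f (suc zero)    = expand c (f 0)
    where
    expand : ∀ c x → + 2 * (1ℤ * (0ℤ + 1ℤ * (c * x)) + 0ℤ) + 0ℤ ≡ (+ 2 * c) * (1ℤ * x + 0ℤ)
    expand = solve-∀
  mulLin-[2+2x][1][x] c f (suc (suc m)) = expand c (f (suc m)) (f m)
    where
    expand : ∀ c x y → + 2 * (1ℤ * (0ℤ + 1ℤ * (c * x)) + 0ℤ) + + 2 * (1ℤ * (0ℤ + 1ℤ * (c * y)) + 0ℤ)
                       ≡ (+ 2 * c) * (1ℤ * x + 1ℤ * y)
    expand = solve-∀

  mulLin-[1][x] : ∀ f → mulLin 1ℤ 0ℤ (mulLin 0ℤ 1ℤ f) ≗ shift f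
  mulLin-[1][x] f zero    = refl
  mulLin-[1][x] f (suc m) = expand (f (suc m)) (f m)
    where
    expand : ∀ w x → 1ℤ * (0ℤ * w + 1ℤ * x) + 0ℤ ≡ x
    expand = solve-∀

open import Data.Nat using (_+_; _*_; _∸_)
open import Data.Nat.Properties
  using (+-suc; +-identityʳ; *-suc; m+n∸m≡n; m+n∸n≡m; m∸n+n≡m; *-assoc; *-comm; *-distribˡ-∸; *-cancelʳ-≡;
         *-cancelˡ-≤; m≤m+n; m≤n+m; <⇒≤; _!*_!≢0; *-commutativeSemigroup)
open import Data.Nat.DivMod using (_/_; m*n/n≡m; m/n*n≡m)
open import Data.Nat.Tactic.RingSolver using (solve-∀)
open import Algebra.Properties.CommutativeSemigroup *-commutativeSemigroup using (x∙yz≈y∙xz; xy∙z≈y∙xz)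
import Data.Integer.Properties as ℤₚ

nCk*[k!*[n∸k]!]≡n! : ∀ {n k} → k ≤ n → (n C k) * (k ! * (n ∸ k) !) ≡ n !
nCk*[k!*[n∸k]!]≡n! {n} {k} k≤n = trans (cong (_* (k ! * (n ∸ k) !)) (nCk≡n!/k![n-k]! k≤n))
  (m/n*n≡m {{k !* (n ∸ k) !≢0}} (k![n∸k]!∣n! k≤n))

[k+1]*nC[k+1]≡[n∸k]*nCk : ∀ {n k} → k < n → suc k * (n C suc k) ≡ (n ∸ k) * (n C k)
[k+1]*nC[k+1]≡[n∸k]*nCk {n} {k} k<n = *-cancelʳ-≡ _ _ d {{k !* (n ∸ k) !≢0}} (begin
  (suc k * c′) * d         ≡⟨ xy∙z≈y∙xz (suc k) c′ d ⟩
  c′ * (suc k * d)         ≡⟨ cong (c′ *_) ([n-k]*d[k+1]≡[k+1]*d[k] k<n) ⟨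
  c′ * ((n ∸ k) * d′)      ≡⟨ x∙yz≈y∙xz c′ (n ∸ k) d′ ⟩
  (n ∸ k) * (c′ * d′)      ≡⟨ cong ((n ∸ k) *_) (nCk*[k!*[n∸k]!]≡n! k<n) ⟩
  (n ∸ k) * n !            ≡⟨ cong ((n ∸ k) *_) (nCk*[k!*[n∸k]!]≡n! (<⇒≤ k<n)) ⟨
  (n ∸ k) * (c * d)        ≡⟨ *-assoc (n ∸ k) c d ⟨
  ((n ∸ k) * c) * d        ∎)
  where
  open ≡-Reasoning
  c = n C k
  c′ = n C suc k
  d = k ! * (n ∸ k) !
  d′ = suc k ! * (n ∸ suc k) !

catalan-suc+C≡C : ∀ k → catalan (suc k) + 2 * suc k C k ≡ 2 * suc k C suc k
catalan-suc+C≡C k = begin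
  c / suc K + p                ≡⟨ cong (λ z → z / suc K + p) [c∸p]*[1+K]≡c ⟨
  (c ∸ p) * suc K / suc K + p  ≡⟨ cong (_+ p) (m*n/n≡m (c ∸ p) (suc K)) ⟩
  c ∸ p + p                    ≡⟨ m∸n+n≡m p≤c ⟩
  c                            ∎
  where
  open ≡-Reasoning
  K = suc k
  c = 2 * K C K
  p = 2 * K C k

  2K≡k+[2+K] : ∀ k → 2 * suc k ≡ k + suc (suc k)
  2K≡k+[2+K] = solve-∀

  absorption : K * c ≡ suc K * p
  absorption = trans ([k+1]*nC[k+1]≡[n∸k]*nCk (m≤m+n K (K + 0)))
                     (cong (_* p) (trans (cong (_∸ k) (2K≡k+[2+K] k)) (m+n∸m≡n k (suc K))))

  p≤c : p ≤ c
  p≤c = *-cancelˡ-≤ (suc K) (subst (_≤ suc K * c) absorption (m≤n+m (K * c) c))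

  [c∸p]*[1+K]≡c : (c ∸ p) * suc K ≡ c
  [c∸p]*[1+K]≡c = begin
    (c ∸ p) * suc K        ≡⟨ *-comm (c ∸ p) (suc K) ⟩
    suc K * (c ∸ p)        ≡⟨ *-distribˡ-∸ (suc K) c p ⟩
    suc K * c ∸ suc K * p  ≡⟨ cong (suc K * c ∸_) absorption ⟨
    c + K * c ∸ K * c      ≡⟨ m+n∸n≡m c (K * c) ⟩
    c                      ∎

[1-x][1+x]^2k≡catalan : ∀ k → mulLin 1ℤ -1ℤ ([1+x]^ (2 * k)) k ≡ + catalan k
[1-x][1+x]^2k≡catalan zero    = refl
[1-x][1+x]^2k≡catalan (suc k) = mulLin-1-[-1]-suc ([1+x]^ (2 * suc k)) k
  (trans (cong +_ (sym (catalan-suc+C≡C k))) (ℤₚ.pos-+ (catalan (suc k)) (2 * suc k C k)))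

linProd : ℕ → ℕ → Poly
linProd zero    j = 1ℤ ∷ []
linProd (suc a) j = lin (+ a) (+ j) ⊗ linProd a (suc j)

foldr-factors≡linProd : ∀ m n j {f : ℕ → ℕ} → m ≡ j + n → (∀ i → f i ≡ j + i) →
  foldr (λ i q → lin (+ (m ∸ 1 ∸ i)) (+ i) ⊗ q) (1ℤ ∷ []) (applyUpTo f n) ≡ linProd n j
foldr-factors≡linProd m zero    j _     _    = refl
foldr-factors≡linProd m (suc n) j {f} m≡j+n f≗j+ = begin
  lin (+ (m ∸ 1 ∸ f 0)) (+ f 0) ⊗ foldr _ (1ℤ ∷ []) (applyUpTo (λ i → f (suc i)) n)
    ≡⟨ cong₂ (λ i q → lin (+ (m ∸ 1 ∸ i)) (+ i) ⊗ q) (trans (f≗j+ 0) (+-identityʳ j))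
             (foldr-factors≡linProd m n (suc j) m≡1+j+n (λ i → trans (f≗j+ (suc i)) (+-suc j i))) ⟩
  lin (+ (m ∸ 1 ∸ j)) (+ j) ⊗ linProd n (suc j)
    ≡⟨ cong (λ a → lin (+ a) (+ j) ⊗ linProd n (suc j))
            (trans (cong (λ x → x ∸ 1 ∸ j) m≡1+j+n) (m+n∸m≡n j n)) ⟩
  linProd (suc n) j ∎
  where
  open ≡-Reasoning
  m≡1+j+n : m ≡ suc j + n
  m≡1+j+n = trans m≡j+n (+-suc j n)

prodPoly≡linProd : ∀ m → prodPoly m ≡ linProd m 0
prodPoly≡linProd m = foldr-factors≡linProd m m 0 refl (λ _ → refl)

coeff-linProd-suc-≋ : ∀ {d a j a′ b′ g} → + a ≈ a′ [mod d ] → + j ≈ b′ [mod d ] →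
                      coeff (linProd a (suc j)) ≋ g [mod d ] →
                      coeff (linProd (suc a) j) ≋ mulLin a′ b′ g [mod d ]
coeff-linProd-suc-≋ {a = a} {j} a≈a′ j≈b′ linProd≋g =
  ≋-trans {g = mulLin (+ a) (+ j) (coeff (linProd a (suc j)))}
          (≋-reflexive (coeff-lin-⊗ (+ a) (+ j) (linProd a (suc j)))) (mulLin-cong a≈a′ j≈b′ linProd≋g)

coeff-linProd-3t-3u : ∀ t u → coeff (linProd (t * 3) (u * 3)) ≋ [x+x²]^ t [mod 3 ]
coeff-linProd-3t-3u zero    u = λ { zero → mod-refl ; (suc m) → mod-refl }
coeff-linProd-3t-3u (suc t) u = begin
  coeff (linProd (suc t * 3) (u * 3))
    ≈⟨ coeff-linProd-suc-≋ (+[r+q*n]≈+r 2 t) (+[r+q*n]≈+r 0 u)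
         (coeff-linProd-suc-≋ (+[r+q*n]≈+r 1 t) (+[r+q*n]≈+r 1 u)
           (coeff-linProd-suc-≋ (+[r+q*n]≈+r 0 t) (+[r+q*n]≈+r 2 u) (coeff-linProd-3t-3u t (suc u)))) ⟩
  mulLin (+ 2) 0ℤ (mulLin 1ℤ 1ℤ (mulLin 0ℤ (+ 2) ([x+x²]^ t)))
    ≈⟨ ≋-reflexive (mulLin-[2][1+x][2x] ([x+x²]^ t)) ⟩
  (+ 4) · shift (mulLin 1ℤ 1ℤ ([x+x²]^ t))
    ≈⟨ c≈1⇒c·f≋f (+[r+q*n]≈+r 1 1) ⟩
  shift (mulLin 1ℤ 1ℤ ([x+x²]^ t))
    ≈⟨ ≋-reflexive ([x+x²]^-suc t) ⟩
  [x+x²]^ (suc t) ∎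
  where open SetoidReasoning (≋-setoid 3)

coeff-linProd-3t-3u+2 : ∀ t u → coeff (linProd (t * 3) (2 + u * 3)) ≋ ((+ 2) ℤ.^ t) · [x+x²]^ t [mod 3 ]
coeff-linProd-3t-3u+2 zero    u = λ { zero → mod-refl ; (suc m) → mod-refl }
coeff-linProd-3t-3u+2 (suc t) u = begin
  coeff (linProd (suc t * 3) (2 + u * 3))
    ≈⟨ coeff-linProd-suc-≋ (+[r+q*n]≈+r 2 t) (+[r+q*n]≈+r 2 u)
         (coeff-linProd-suc-≋ (+[r+q*n]≈+r 1 t) (+[r+q*n]≈+r 0 (suc u))
           (coeff-linProd-suc-≋ (+[r+q*n]≈+r 0 t) (+[r+q*n]≈+r 1 (suc u)) (coeff-linProd-3t-3u+2 t (suc u)))) ⟩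
  mulLin (+ 2) (+ 2) (mulLin 1ℤ 0ℤ (mulLin 0ℤ 1ℤ (((+ 2) ℤ.^ t) · [x+x²]^ t)))
    ≈⟨ ≋-reflexive (mulLin-[2+2x][1][x] ((+ 2) ℤ.^ t) ([x+x²]^ t)) ⟩
  ((+ 2) ℤ.^ suc t) · shift (mulLin 1ℤ 1ℤ ([x+x²]^ t))
    ≈⟨ ·-cong (mod-refl {a = (+ 2) ℤ.^ suc t}) (≋-reflexive ([x+x²]^-suc t)) ⟩
  ((+ 2) ℤ.^ suc t) · [x+x²]^ (suc t) ∎
  where open SetoidReasoning (≋-setoid 3)

2^[2k]≈1 : ∀ k → ((+ 2) ℤ.^ (2 * k)) ≈ 1ℤ [mod 3 ]
2^[2k]≈1 zero    = mod-refl
2^[2k]≈1 (suc k) = subst (λ e → (+ 2) ℤ.^ e ≈ 1ℤ [mod 3 ]) (sym (*-suc 2 k))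
  (mod-trans (*-cong-mod (mod-refl {a = + 2}) (*-cong-mod (mod-refl {a = + 2}) (2^[2k]≈1 k)))
             (+[r+q*n]≈+r 1 1))

coeff-linProd-6k+2 : ∀ k → coeff (linProd (2 + 2 * k * 3) 0) ≋ shift ([x+x²]^ (2 * k)) [mod 3 ]
coeff-linProd-6k+2 k = begin
  coeff (linProd (2 + 2 * k * 3) 0)
    ≈⟨ coeff-linProd-suc-≋ (+[r+q*n]≈+r 1 (2 * k)) (+[r+q*n]≈+r 0 0)
         (coeff-linProd-suc-≋ (+[r+q*n]≈+r 0 (2 * k)) (+[r+q*n]≈+r 1 0)
           (≋-trans (coeff-linProd-3t-3u+2 (2 * k) 0) (c≈1⇒c·f≋f (2^[2k]≈1 k)))) ⟩
  mulLin 1ℤ 0ℤ (mulLin 0ℤ 1ℤ ([x+x²]^ (2 * k)))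
    ≈⟨ ≋-reflexive (mulLin-[1][x] ([x+x²]^ (2 * k))) ⟩
  shift ([x+x²]^ (2 * k)) ∎
  where open SetoidReasoning (≋-setoid 3)

-- The right-hand side is reached by computation: 0ℤ * x reduces to 0ℤ.
coeff-linProd-3t+1 : ∀ t → coeff (linProd (1 + t * 3) 0) ≋ (λ _ → 0ℤ) [mod 3 ]
coeff-linProd-3t+1 t = coeff-linProd-suc-≋ (+[r+q*n]≈+r 0 t) (+[r+q*n]≈+r 0 0) (λ m → mod-refl)

v-suc : ∀ n → v (suc n) ≡ mulLin 1ℤ -1ℤ (coeff (linProd (2 * n) 0)) n
v-suc n = trans (coeff-lin-⊗ 1ℤ -1ℤ (prodPoly (2 * n)) n)
                (cong (λ p → mulLin 1ℤ -1ℤ (coeff p) n) (prodPoly≡linProd (2 * n)))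

v-suc-≈ : ∀ n {d a g} → 2 * n ≡ a → coeff (linProd a 0) ≋ g [mod d ] →
          v (suc n) ≈ mulLin 1ℤ -1ℤ g n [mod d ]
v-suc-≈ n refl linProd≋g =
  mod-trans (mod-reflexive (v-suc n)) (mulLin-cong {a = 1ℤ} {b = -1ℤ} mod-refl mod-refl linProd≋g n)

3k≡2k+k : ∀ k → 3 * k ≡ 2 * k + k
3k≡2k+k = solve-∀

v[1+3k]≈catalan : ∀ k → v (1 + 3 * k) ≈ + catalan k [mod 3 ]
v[1+3k]≈catalan k = begin
  v (1 + 3 * k)
    ≈⟨ v-suc-≈ (3 * k) (6k≡2k*3 k) (coeff-linProd-3t-3u (2 * k) 0) ⟩
  mulLin 1ℤ -1ℤ ([x+x²]^ (2 * k)) (3 * k)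
    ≡⟨ cong (mulLin 1ℤ -1ℤ ([x+x²]^ (2 * k))) (3k≡2k+k k) ⟩
  mulLin 1ℤ -1ℤ ([x+x²]^ (2 * k)) (2 * k + k)
    ≡⟨ mulLin-shiftBy-+ (2 * k) 1ℤ -1ℤ ([1+x]^ (2 * k)) k ⟩
  mulLin 1ℤ -1ℤ ([1+x]^ (2 * k)) k
    ≡⟨ [1-x][1+x]^2k≡catalan k ⟩
  + catalan k ∎
  where
  open SetoidReasoning (mod-setoid 3)
  6k≡2k*3 : ∀ k → 2 * (3 * k) ≡ 2 * k * 3
  6k≡2k*3 = solve-∀

v[2+3k]≈catalan : ∀ k → v (2 + 3 * k) ≈ + catalan k [mod 3 ]
v[2+3k]≈catalan k = begin
  v (2 + 3 * k)
    ≈⟨ v-suc-≈ (1 + 3 * k) (6k+2≡2+2k*3 k) (coeff-linProd-6k+2 k) ⟩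
  mulLin 1ℤ -1ℤ (shift ([x+x²]^ (2 * k))) (1 + 3 * k)
    ≡⟨ cong (λ i → mulLin 1ℤ -1ℤ (shift ([x+x²]^ (2 * k))) (suc i)) (3k≡2k+k k) ⟩
  mulLin 1ℤ -1ℤ (shift ([x+x²]^ (2 * k))) (1 + 2 * k + k)
    ≡⟨ mulLin-shiftBy-+ (1 + 2 * k) 1ℤ -1ℤ ([1+x]^ (2 * k)) k ⟩
  mulLin 1ℤ -1ℤ ([1+x]^ (2 * k)) k
    ≡⟨ [1-x][1+x]^2k≡catalan k ⟩
  + catalan k ∎
  where
  open SetoidReasoning (mod-setoid 3)
  6k+2≡2+2k*3 : ∀ k → 2 * (1 + 3 * k) ≡ 2 + 2 * k * 3
  6k+2≡2+2k*3 = solve-∀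

-- 3 * suc k reduces to suc (k + 2 * suc k).
v[3+3k]≈0 : ∀ k → v (3 * suc k) ≈ 0ℤ [mod 3 ]
v[3+3k]≈0 k = mod-trans (v-suc-≈ (k + 2 * suc k) (6k+4≡1+[1+2k]*3 k) (coeff-linProd-3t+1 (1 + 2 * k)))
                        (mod-reflexive (mulLin-zero 1ℤ -1ℤ (k + 2 * suc k)))
  where
  6k+4≡1+[1+2k]*3 : ∀ k → 2 * (k + 2 * suc k) ≡ 1 + (1 + 2 * k) * 3
  6k+4≡1+[1+2k]*3 = solve-∀

mainTheorem10 : (∀ (k : ℕ) → (v (1 + 3 * k) ≡ v (2 + 3 * k) [mod 3 ]) × (v (2 + 3 * k) ≡ + catalan k [mod 3 ]))
    × (∀ (k : ℕ) → v (3 * suc k) ≡ + 0 [mod 3 ])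
mainTheorem10 =
  (λ k → ≈⇒≡mod (mod-trans (v[1+3k]≈catalan k) (mod-sym (v[2+3k]≈catalan k)))
       , ≈⇒≡mod (v[2+3k]≈catalan k))
  , λ k → ≈⇒≡mod (v[3+3k]≈0 k)
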